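{- The language $\{w\in\Sigma^* : |w|=2^n \text{ for some } n\ge 0\}$ can be maintained in $\mathsf{DynCQ}$.
   Context: Dynamic setting. Fix a finite alphabet $\Sigma$. A word-structure has domain $D=\{1,\dots,n+1\}$ ($n\ge0$), the linear order $<$, a constant $\$=n+1$, and for each $\zeta\in\Sigma$ a unary relation $R_\zeta\subseteq\{1,\dots,n\}$, each position in at most one $R_\zeta$. Write $w(i)=\zeta$ if $R_\zeta(i)$ and $w(i)=\varepsilon$ otherwise; the current word is $w=w(1)\cdots w(n)$. Updates $\mathsf{ins}_\zeta(i)$ (set $w(i)=\zeta$) and $\mathsf{reset}(i)$ (set $w(i)=\varepsilon$), $i\le n$, are allowed only if they change the word-structure; initially all positions are $\varepsilon$. A dynamic program has finitely many auxiliary relations over $D$ (possibly 0-ary), initialized by first-order formulas, and for each auxiliary relation $R$ (arity $k$) and each abstract update $\mathsf{op}$ an update formula $\varphi^R_{\mathsf{op}}(y;x_1,\dots,x_k)$; after applying $\mathsf{op}$ at $i$, the new $R$ is the set of $\vec j$ with $\varphi^R_{\mathsf{op}}(i;\vec j)$ true in the updated word-structure with the old auxiliary relations. A program maintains a language $L$ if a designated 0-ary auxiliary relation is true exactly when the current word is in $L$, after every sequence of updates. $\mathsf{DynCQ}$: all update formulas are conjunctive queries (built from atoms by conjunction and existential quantification). -}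

module Defs where

open import Data.Nat using (ℕ; zero; suc; _^_)
open import Data.Fin using (Fin; zero; suc; inject₁; fromℕ; _<_; _≟_)
open import Data.Maybe using (Maybe; just; nothing)
open import Data.Vec using (Vec; []; _∷_; lookup; map)
open import Data.List using (List; length; catMaybes; tabulate)
open import Data.Product using (Σ; ∃-syntax; _×_; _,_)
open import Data.Sum using (_⊎_)
open import Data.Empty using (⊥)
open import Relation.Nullary using (¬_; does)
open import Relation.Binary.PropositionalEquality using (_≡_; _≢_)
open import Data.Bool using (if_then_else_)
open import Function.Bundles using (_⇔_)

-- Domain D = Fin (suc n), where
-- the element inject₁ j (j : Fin n) is position j+1 and fromℕ n is $ = n+1.
-- The order < is the order of Fin.  A word-structure is given by
-- w : Fin n → Maybe (Fin s)  (nothing = ε, just ζ = R_ζ holds there).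

Word : ℕ → ℕ → Set
Word s n = Fin n → Maybe (Fin s)

-- letter at an element of the domain ($ never carries a letter)
at : ∀ {s n} → Word s n → Fin (suc n) → Maybe (Fin s)
at {n = zero}  w zero    = nothing
at {n = suc n} w zero    = w zero
at {n = suc n} w (suc i) = at (λ j → w (suc j)) i

word : ∀ {s n} → Word s n → List (Fin s)
word {n = n} w = catMaybes (tabulate w)

emptyWord : ∀ {s n} → Word s n
emptyWord _ = nothing

PowLen : ∀ {s} → List (Fin s) → Set
PowLen u = ∃[ e ] length u ≡ 2 ^ e

data Term (k : ℕ) : Set where
  var    : Fin k → Term k
  dollar : Term k

data Atom (s m : ℕ) (ar : Fin m → ℕ) (k : ℕ) : Set where
  lt     : Term k → Term k → Atom s m ar k
  eq     : Term k → Term k → Atom s m ar k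
  letter : Fin s → Term k → Atom s m ar k
  aux    : (r : Fin m) → Vec (Term k) (ar r) → Atom s m ar k

data CQ (s m : ℕ) (ar : Fin m → ℕ) : ℕ → Set where
  atom  : ∀ {k} → Atom s m ar k → CQ s m ar k
  _∧_   : ∀ {k} → CQ s m ar k → CQ s m ar k → CQ s m ar k
  ex    : ∀ {k} → CQ s m ar (suc k) → CQ s m ar k

data FO (s m : ℕ) (ar : Fin m → ℕ) : ℕ → Set where
  atom  : ∀ {k} → Atom s m ar k → FO s m ar k
  neg   : ∀ {k} → FO s m ar k → FO s m ar k
  _∧_   : ∀ {k} → FO s m ar k → FO s m ar k → FO s m ar k
  _∨_   : ∀ {k} → FO s m ar k → FO s m ar k → FO s m ar k
  ex    : ∀ {k} → FO s m ar (suc k) → FO s m ar k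
  all   : ∀ {k} → FO s m ar (suc k) → FO s m ar k

noAux : Fin 0 → ℕ
noAux ()

AuxInt : (n m : ℕ) → (Fin m → ℕ) → Set₁
AuxInt n m ar = (r : Fin m) → Vec (Fin (suc n)) (ar r) → Set

noAuxInt : ∀ {n} → AuxInt n 0 noAux
noAuxInt ()

extend : ∀ {n k} → Fin (suc n) → (Fin k → Fin (suc n)) → Fin (suc k) → Fin (suc n)
extend d ρ zero    = d
extend d ρ (suc i) = ρ i

module _ {s m : ℕ} {ar : Fin m → ℕ} {n : ℕ}
         (w : Word s n) (A : AuxInt n m ar) where

  evalT : ∀ {k} → (Fin k → Fin (suc n)) → Term k → Fin (suc n)
  evalT ρ (var x) = ρ x
  evalT ρ dollar  = fromℕ n

  SatAtom : ∀ {k} → Atom s m ar k → (Fin k → Fin (suc n)) → Set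
  SatAtom (lt t u)     ρ = evalT ρ t < evalT ρ u
  SatAtom (eq t u)     ρ = evalT ρ t ≡ evalT ρ u
  SatAtom (letter ζ t) ρ = at w (evalT ρ t) ≡ just ζ
  SatAtom (aux r ts)   ρ = A r (map (evalT ρ) ts)

  SatCQ : ∀ {k} → CQ s m ar k → (Fin k → Fin (suc n)) → Set
  SatCQ (atom a) ρ = SatAtom a ρ
  SatCQ (φ ∧ ψ)  ρ = SatCQ φ ρ × SatCQ ψ ρ
  SatCQ (ex φ)   ρ = Σ (Fin (suc n)) λ d → SatCQ φ (extend d ρ)

  SatFO : ∀ {k} → FO s m ar k → (Fin k → Fin (suc n)) → Set
  SatFO (atom a) ρ = SatAtom a ρ
  SatFO (neg φ)  ρ = ¬ SatFO φ ρ
  SatFO (φ ∧ ψ)  ρ = SatFO φ ρ × SatFO ψ ρ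
  SatFO (φ ∨ ψ)  ρ = SatFO φ ρ ⊎ SatFO ψ ρ
  SatFO (ex φ)   ρ = Σ (Fin (suc n)) λ d → SatFO φ (extend d ρ)
  SatFO (all φ)  ρ = (d : Fin (suc n)) → SatFO φ (extend d ρ)

data Update (s n : ℕ) : Set where
  ins   : Fin s → Fin n → Update s n
  reset : Fin n → Update s n

Allowed : ∀ {s n} → Word s n → Update s n → Set
Allowed w (ins ζ i) = w i ≢ just ζ
Allowed w (reset i) = w i ≢ nothing

applyUpd : ∀ {s n} → Word s n → Update s n → Word s n
applyUpd w (ins ζ i) j = if does (j ≟ i) then just ζ else w j
applyUpd w (reset i) j = if does (j ≟ i) then nothing else w j

position : ∀ {s n} → Update s n → Fin n
position (ins _ i) = i
position (reset i) = i

-- An update formula for a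
-- k-ary relation has k+1 free variables: variable 0 is y (the update
-- position), variable (suc j) is x_(j+1).

record DynCQProgram (s : ℕ) : Set where
  field
    m      : ℕ
    ar     : Fin m → ℕ
    init   : (r : Fin m) → FO s 0 noAux (ar r)
    updIns : Fin s → (r : Fin m) → CQ s m ar (suc (ar r))
    updRes : (r : Fin m) → CQ s m ar (suc (ar r))

module Run {s : ℕ} (P : DynCQProgram s) where
  open DynCQProgram P

  updFormula : ∀ {n} → Update s n → (r : Fin m) → CQ s m ar (suc (ar r))
  updFormula (ins ζ _) r = updIns ζ r
  updFormula (reset _) r = updRes r

  initAux : ∀ {n} → AuxInt n m ar
  initAux r t = SatFO emptyWord noAuxInt (init r) (lookup t)

  stepAux : ∀ {n} → Word s n → AuxInt n m ar → Update s n → AuxInt n m ar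
  stepAux w A u r t =
    SatCQ (applyUpd w u) A (updFormula u r) (extend (inject₁ (position u)) (lookup t))

  data Reachable {n : ℕ} : Word s n → AuxInt n m ar → Set₁ where
    start : Reachable emptyWord initAux
    step  : ∀ {w A} (u : Update s n) → Reachable w A → Allowed w u →
            Reachable (applyUpd w u) (stepAux w A u)

Maintains : ∀ {s} → (P : DynCQProgram s) → Fin (DynCQProgram.m P) →
            (List (Fin s) → Set) → Set₁
Maintains {s} P q L =
  DynCQProgram.ar P q ≡ 0 ×
  (∀ {n} (w : Word s n) (A : AuxInt n (DynCQProgram.m P) (DynCQProgram.ar P)) →
     Run.Reachable P w A →
     (t : Vec (Fin (suc n)) (DynCQProgram.ar P q)) → A q t ⇔ L (word w))

MaintainableInDynCQ : ∀ {s} → (List (Fin s) → Set) → Set₁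
MaintainableInDynCQ {s} L =
  Σ (DynCQProgram s) λ P → Σ (Fin (DynCQProgram.m P)) λ q → Maintains P q L

-- The program stores, as domain elements, the number c of letters of the current
-- word, the largest value M that c has taken so far, the distance D from M + 1 to
-- the next power of two, and the table of powers of two up to M. An insertion into
-- an empty position increments c; if c passes M then M grows, and M + 1 is a power
-- of two exactly when D = 0, in which case D restarts at M (otherwise it decreases).
-- Since c ≤ M, the word has length 2^e iff c is in the table.
--
-- Conjunctive queries have neither negation nor disjunction, so Booleans are domain
-- elements and every auxiliary relation besides the query is the graph of a
-- function. Successor, predecessor, equality test and if-then-else are first-order
-- definable from the order, fixed at initialisation and never updated; any
-- straight-line composition of functions given by graphs is a conjunctive query
-- that quantifies existentially over the intermediate values.

module Submission where

open import Defs
open import Data.Bool using (Bool; true; false; T; if_then_else_) renaming (_∧_ to _∧ᵇ_; _∨_ to _∨ᵇ_)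
open import Data.Bool.Properties using (if-float; T-∨)
open import Data.Fin as Fin using (Fin; zero; suc; toℕ; fromℕ; inject₁; _≟_; #_)
open import Data.Fin.Properties using (toℕ-injective; toℕ-inject₁; toℕ-fromℕ; toℕ<n; toℕ-fromℕ<; toℕ≤pred[n])
open import Data.List using (length; tabulate)
open import Data.List.Properties using (length-catMaybes; length-tabulate)
open import Data.Maybe using (Maybe; just; nothing; is-nothing)
open import Data.Nat using (ℕ)
open import Data.Nat as ℕ using (suc; _+_; _^_; _≤_; _<_; z≤n; s≤s)
open import Data.Nat.Properties hiding (_≟_)
open import Algebra.Properties.CommutativeSemigroup +-commutativeSemigroup using (x∙yz≈y∙xz)
open import Data.Product using (Σ; ∃-syntax; _×_; _,_; proj₁; proj₂)
open import Data.Product.Function.NonDependent.Propositional using (_×-⇔_)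
open import Data.Sum using (_⊎_; inj₁; inj₂; [_,_])
open import Data.Sum.Function.Propositional using (_⊎-⇔_)
open import Data.Vec as Vec using (Vec; []; _∷_)
open import Data.Vec.Properties using (map-∘; map-cong; tabulate-∘; tabulate∘lookup)
open import Function using (id; _∘_)
open import Function.Bundles using (_⇔_; mk⇔; Equivalence)
open import Function.Construct.Composition using (_⇔-∘_)
open import Function.Construct.Symmetry using (⇔-sym)
open import Relation.Binary.Definitions using (tri<; tri≈; tri>)
open import Relation.Binary.PropositionalEquality using (_≡_; _≢_; refl; sym; trans; cong; cong₂; subst; module ≡-Reasoning)
open import Relation.Nullary using (¬_; Dec; yes; no; does; contradiction)
open import Relation.Nullary.Decidable using (True)

≡⇔ : ∀ {A : Set} {x a b : A} → a ≡ b → x ≡ a ⇔ x ≡ b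
≡⇔ a≡b = mk⇔ (λ x≡a → trans x≡a a≡b) (λ x≡b → trans x≡b (sym a≡b))

T-does : ∀ {P : Set} (P? : Dec P) → T (does P?) ⇔ P
T-does (yes p) = mk⇔ (λ _ → p) _
T-does (no ¬p) = mk⇔ (λ ()) ¬p

≤-suc-cases : ∀ {x M} → x ≤ suc M → x ≡ suc M ⊎ x ≤ M
≤-suc-cases x≤M+1 with m≤n⇒m<n∨m≡n x≤M+1
... | inj₁ x<M+1 = inj₂ (ℕ.s≤s⁻¹ x<M+1)
... | inj₂ x≡M+1 = inj₁ x≡M+1

IsPow : ℕ → Set
IsPow k = ∃[ e ] k ≡ 2 ^ e

¬isPow-0 : ¬ IsPow 0
¬isPow-0 (e , 0≡2^e) = <⇒≢ (m^n>0 2 e) 0≡2^e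

2^-suc : ∀ e → 2 ^ suc e ≡ 2 ^ e + 2 ^ e
2^-suc e = cong (2 ^ e +_) (+-identityʳ (2 ^ e))

isPow-suc⇒≡0 : ∀ {M D} → D ≤ M → IsPow (suc M + D) → IsPow (suc M) → D ≡ 0
isPow-suc⇒≡0 {M} {D} D≤M (b , M+D≡2^b) (a , M≡2^a) with <-cmp a b
... | tri< a<b _ _ = contradiction 2^b<2^b (<-irrefl refl)
  where
  open ≤-Reasoning
  2^b<2^b : 2 ^ b < 2 ^ b
  2^b<2^b = begin-strict
    2 ^ b          ≡⟨ M+D≡2^b ⟨
    suc M + D      <⟨ +-monoʳ-< (suc M) (s≤s D≤M) ⟩
    suc M + suc M  ≡⟨ cong₂ _+_ M≡2^a M≡2^a ⟩
    2 ^ a + 2 ^ a  ≡⟨ 2^-suc a ⟨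
    2 ^ suc a      ≤⟨ ^-monoʳ-≤ 2 a<b ⟩
    2 ^ b          ∎
... | tri≈ _ refl _ = +-cancelˡ-≡ (suc M) D 0 (trans (trans M+D≡2^b (sym M≡2^a)) (sym (+-identityʳ _)))
... | tri> _ _ b<a = contradiction 2^a<2^a (<-irrefl refl)
  where
  open ≤-Reasoning
  2^a<2^a : 2 ^ a < 2 ^ a
  2^a<2^a = begin-strict
    2 ^ a      ≡⟨ M≡2^a ⟨
    suc M      ≤⟨ m≤m+n (suc M) D ⟩
    suc M + D  ≡⟨ M+D≡2^b ⟩
    2 ^ b      <⟨ ^-monoʳ-< 2 (s≤s (s≤s z≤n)) b<a ⟩
    2 ^ a      ∎

isPow-suc⇔≡0 : ∀ {M D} → D ≤ M → IsPow (suc M + D) → IsPow (suc M) ⇔ D ≡ 0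
isPow-suc⇔≡0 {M} D≤M pow = mk⇔ (isPow-suc⇒≡0 D≤M pow) λ { refl → subst IsPow (+-identityʳ (suc M)) pow }

module _ {s : ℕ} where

  _[_]≔_ : ∀ {n} → Word s n → Fin n → Maybe (Fin s) → Word s n
  (w [ i ]≔ v) j = if does (j ≟ i) then v else w j

  filled : ∀ {n} → Word s n → ℕ
  filled w = length (word w)

  size : Maybe (Fin s) → ℕ
  size nothing  = 0
  size (just _) = 1

  filled-suc : ∀ {n} (w : Word s (suc n)) → filled w ≡ size (w zero) + filled (w ∘ suc)
  filled-suc w with w zero
  ... | nothing = refl
  ... | just _  = refl

  filled≤ : ∀ {n} (w : Word s n) → filled w ≤ n
  filled≤ {n} w = ≤-trans (length-catMaybes (tabulate w)) (≤-reflexive (length-tabulate w))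

  filled-empty : ∀ {n} → filled (emptyWord {s} {n}) ≡ 0
  filled-empty {ℕ.zero} = refl
  filled-empty {suc n}  = filled-empty {n}

  filled-update : ∀ {n} (w : Word s n) i v → size (w i) + filled (w [ i ]≔ v) ≡ size v + filled w
  filled-update {suc n} w zero v = begin
    size (w zero) + filled (w [ zero ]≔ v)       ≡⟨ cong (size (w zero) +_) (filled-suc (w [ zero ]≔ v)) ⟩
    size (w zero) + (size v + filled (w ∘ suc))  ≡⟨ x∙yz≈y∙xz (size (w zero)) (size v) _ ⟩
    size v + (size (w zero) + filled (w ∘ suc))  ≡⟨ cong (size v +_) (filled-suc w) ⟨
    size v + filled w                            ∎
    where open ≡-Reasoning
  filled-update {suc n} w (suc i) v = begin
    size (w (suc i)) + filled (w [ suc i ]≔ v)                        ≡⟨ cong (size (w (suc i)) +_) (filled-suc (w [ suc i ]≔ v)) ⟩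
    size (w (suc i)) + (size (w zero) + filled ((w ∘ suc) [ i ]≔ v))  ≡⟨ x∙yz≈y∙xz (size (w (suc i))) (size (w zero)) _ ⟩
    size (w zero) + (size (w (suc i)) + filled ((w ∘ suc) [ i ]≔ v))  ≡⟨ cong (size (w zero) +_) (filled-update (w ∘ suc) i v) ⟩
    size (w zero) + (size v + filled (w ∘ suc))                       ≡⟨ x∙yz≈y∙xz (size (w zero)) (size v) _ ⟩
    size v + (size (w zero) + filled (w ∘ suc))                       ≡⟨ cong (size v +_) (filled-suc w) ⟨
    size v + filled w                                                 ∎
    where open ≡-Reasoning

  filled-ins : ∀ {n} (w : Word s n) i ζ → filled (w [ i ]≔ just ζ) ≡ (if is-nothing (w i) then suc (filled w) else filled w)
  filled-ins w i ζ with w i | filled-update w i (just ζ)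
  ... | nothing | step = step
  ... | just _  | step = suc-injective step

  filled-reset : ∀ {n} (w : Word s n) i → w i ≢ nothing → suc (filled (w [ i ]≔ nothing)) ≡ filled w
  filled-reset w i filled-i with w i | filled-update w i nothing
  ... | nothing | _    = contradiction refl filled-i
  ... | just _  | step = step

  at-inject₁ : ∀ {n} (w : Word s n) i → at w (inject₁ i) ≡ w i
  at-inject₁ {suc n} w zero    = refl
  at-inject₁ {suc n} w (suc i) = at-inject₁ (w ∘ suc) i

  at-empty : ∀ {n} (p : Fin (suc n)) → at (emptyWord {s} {n}) p ≡ nothing
  at-empty {ℕ.zero} zero    = refl
  at-empty {suc n}  zero    = refl
  at-empty {suc n}  (suc p) = at-empty {n} p

  at-update : ∀ {n} (w : Word s n) i v p → at (w [ i ]≔ v) p ≡ (if does (p ≟ inject₁ i) then v else at w p)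
  at-update {suc n} w zero    v zero    = refl
  at-update {suc n} w (suc i) v zero    = refl
  at-update {suc n} w zero    v (suc p) = refl
  at-update {suc n} w (suc i) v (suc p) = at-update (w ∘ suc) i v p

-- true is the least element and false is $; they differ as soon as the word has a
-- position, and then ite (bit b) computes to if b.
module _ {n : ℕ} where

  bit : Bool → Fin (suc n)
  bit b = if b then zero else fromℕ n

  ite : Fin (suc n) → Fin (suc n) → Fin (suc n) → Fin (suc n)
  ite c a b = if does (c ≟ zero) then a else b

  eqBit : Fin (suc n) → Fin (suc n) → Fin (suc n)
  eqBit x y = bit (does (x ≟ y))

module _ {n : ℕ} where

  ite-bit : ∀ b {x y : Fin (suc (suc n))} → ite (bit b) x y ≡ (if b then x else y)
  ite-bit true  = refl
  ite-bit false = refl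

  zero≡bit⇔T : ∀ {b} → zero ≡ bit {suc n} b ⇔ T b
  zero≡bit⇔T {true}  = mk⇔ _ (λ _ → refl)
  zero≡bit⇔T {false} = mk⇔ (λ ()) λ ()

  ite-bit-∧ : ∀ a {b} → ite {suc n} (bit a) (bit b) (bit false) ≡ bit (a ∧ᵇ b)
  ite-bit-∧ true  = refl
  ite-bit-∧ false = refl

  ite-bit-∨ : ∀ a {b} → ite {suc n} (bit a) (bit true) (bit b) ≡ bit (a ∨ᵇ b)
  ite-bit-∨ true  = refl
  ite-bit-∨ false = refl

sat-suc : ∀ {n} → Fin (suc n) → Fin (suc n)
sat-suc {ℕ.zero} zero    = zero
sat-suc {suc n}  zero    = suc zero
sat-suc {suc n}  (suc a) = suc (sat-suc a)

sat-suc-fromℕ : ∀ n → sat-suc (fromℕ n) ≡ fromℕ n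
sat-suc-fromℕ ℕ.zero  = refl
sat-suc-fromℕ (suc n) = cong suc (sat-suc-fromℕ n)

toℕ-sat-suc : ∀ {n} (a : Fin (suc n)) → toℕ a < n → toℕ (sat-suc a) ≡ suc (toℕ a)
toℕ-sat-suc {suc n} zero    _       = refl
toℕ-sat-suc {suc n} (suc a) (s≤s a<n) = cong suc (toℕ-sat-suc a a<n)

sat-suc-graph : ∀ {n} (a y : Fin (suc n)) → y ≡ sat-suc a ⇔ (toℕ y ≡ suc (toℕ a) ⊎ (a ≡ fromℕ n × y ≡ fromℕ n))
sat-suc-graph {n} a y with a ≟ fromℕ n
... | yes refl = mk⇔ (λ y≡ → inj₂ (refl , trans y≡ (sat-suc-fromℕ n)))
                     [ (λ y≡n+1 → contradiction (subst (_≤ n) (trans y≡n+1 (cong suc (toℕ-fromℕ n))) (toℕ≤pred[n] y)) 1+n≰n)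
                     , (λ (_ , y≡$) → trans y≡$ (sym (sat-suc-fromℕ n))) ]
... | no a≢$ = mk⇔ (λ y≡ → inj₁ (trans (cong toℕ y≡) (toℕ-sat-suc a a<n)))
                   [ (λ y≡a+1 → toℕ-injective (trans y≡a+1 (sym (toℕ-sat-suc a a<n)))) , (λ (a≡$ , _) → contradiction a≡$ a≢$) ]
  where
  a<n : toℕ a < n
  a<n = ≤∧≢⇒< (toℕ≤pred[n] a) (λ a≡n → a≢$ (toℕ-injective (trans a≡n (sym (toℕ-fromℕ n)))))

toℕ-pred : ∀ {n} (a : Fin n) → toℕ (Fin.pred a) ≡ ℕ.pred (toℕ a)
toℕ-pred zero    = refl
toℕ-pred (suc a) = toℕ-inject₁ a

pred-graph : ∀ {n} (a y : Fin (suc n)) → y ≡ Fin.pred a ⇔ (toℕ a ≡ suc (toℕ y) ⊎ (a ≡ zero × y ≡ a))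
pred-graph zero    y = mk⇔ (λ y≡0 → inj₂ (refl , y≡0)) [ (λ ()) , proj₂ ]
pred-graph (suc a) y = mk⇔ (λ y≡a → inj₁ (cong suc (sym (trans (cong toℕ y≡a) (toℕ-inject₁ a)))))
                           [ (λ a≡y → toℕ-injective (trans (sym (suc-injective a≡y)) (sym (toℕ-inject₁ a)))) , (λ ()) ∘ proj₁ ]

-- The countdown is the distance from max + 1 to the next power of two.
record PowerTable {n} (max countdown : Fin (suc n)) (powers : Fin (suc n) → Bool) : Set where
  field
    countdown≤max : toℕ countdown ≤ toℕ max
    isPow-target  : IsPow (suc (toℕ max) + toℕ countdown)
    powers-spec   : ∀ x → T (powers x) ⇔ (toℕ x ≤ toℕ max × IsPow (toℕ x))

module PowerTableGrowth {n} {max countdown : Fin (suc n)} {powers : Fin (suc n) → Bool}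
                        (table : PowerTable max countdown powers) (max<n : toℕ max < n) where
  open PowerTable table

  M : ℕ
  M = toℕ max

  M′≡M+1 : toℕ (sat-suc max) ≡ suc M
  M′≡M+1 = toℕ-sat-suc max max<n

  ≤M⇒≤M′ : ∀ {k} → k ≤ M → k ≤ toℕ (sat-suc max)
  ≤M⇒≤M′ k≤M = ≤-trans (m≤n⇒m≤1+n k≤M) (≤-reflexive (sym M′≡M+1))

  ≤M′⇒≡M′⊎≤M : ∀ {k} → k ≤ toℕ (sat-suc max) → k ≡ suc M ⊎ k ≤ M
  ≤M′⇒≡M′⊎≤M k≤M′ = ≤-suc-cases (subst (_ ≤_) M′≡M+1 k≤M′)

  isPow-M+1⇔ : IsPow (suc M) ⇔ toℕ countdown ≡ 0
  isPow-M+1⇔ = isPow-suc⇔≡0 countdown≤max isPow-target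

  grow-to-power : countdown ≡ zero →
                  PowerTable (sat-suc max) max (λ x → does (x ≟ sat-suc max) ∨ᵇ powers x)
  grow-to-power countdown≡0 = record
    { countdown≤max = ≤M⇒≤M′ ≤-refl
    ; isPow-target  = subst (λ k → IsPow (suc k + M)) (sym M′≡M+1) (suc e , doubled)
    ; powers-spec   = λ x → mk⇔ (to x) (from x)
    }
    where
    open ≡-Reasoning
    pow-M+1 : IsPow (suc M)
    pow-M+1 = Equivalence.from isPow-M+1⇔ (cong toℕ countdown≡0)
    e : ℕ
    e = proj₁ pow-M+1
    doubled : suc (suc M) + M ≡ 2 ^ suc e
    doubled = begin
      suc (suc M) + M  ≡⟨ +-suc (suc M) M ⟨
      suc M + suc M    ≡⟨ cong₂ _+_ (proj₂ pow-M+1) (proj₂ pow-M+1) ⟩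
      2 ^ e + 2 ^ e    ≡⟨ 2^-suc e ⟨
      2 ^ suc e        ∎
    to : ∀ x → T (does (x ≟ sat-suc max) ∨ᵇ powers x) → toℕ x ≤ toℕ (sat-suc max) × IsPow (toℕ x)
    to x t with Equivalence.to T-∨ t
    ... | inj₁ new = let x≡M′ = cong toℕ (Equivalence.to (T-does (x ≟ sat-suc max)) new)
                     in ≤-reflexive x≡M′ , subst IsPow (sym (trans x≡M′ M′≡M+1)) pow-M+1
    ... | inj₂ old = let (x≤M , pow) = Equivalence.to (powers-spec x) old in ≤M⇒≤M′ x≤M , pow
    from : ∀ x → toℕ x ≤ toℕ (sat-suc max) × IsPow (toℕ x) → T (does (x ≟ sat-suc max) ∨ᵇ powers x)
    from x (x≤M′ , pow) with ≤M′⇒≡M′⊎≤M x≤M′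
    ... | inj₁ x≡M+1 = Equivalence.from T-∨ (inj₁ (Equivalence.from (T-does (x ≟ sat-suc max))
                                                      (toℕ-injective (trans x≡M+1 (sym M′≡M+1)))))
    ... | inj₂ x≤M   = Equivalence.from T-∨ (inj₂ (Equivalence.from (powers-spec x) (x≤M , pow)))

  grow-below-power : countdown ≢ zero → PowerTable (sat-suc max) (Fin.pred countdown) powers
  grow-below-power countdown≢0 = record
    { countdown≤max = ≤M⇒≤M′ (≤-trans (≤-trans (≤-reflexive (toℕ-pred countdown)) pred[n]≤n) countdown≤max)
    ; isPow-target  = subst (λ k → IsPow (suc k + toℕ (Fin.pred countdown))) (sym M′≡M+1) (subst IsPow shift isPow-target)
    ; powers-spec   = λ x → mk⇔ (old x ∘ Equivalence.to (powers-spec x)) (Equivalence.from (powers-spec x) ∘ new x)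
    }
    where
    D≢0 : toℕ countdown ≢ 0
    D≢0 = countdown≢0 ∘ toℕ-injective
    shift : suc M + toℕ countdown ≡ suc (suc M) + toℕ (Fin.pred countdown)
    shift = trans (+-pred D≢0) (cong (suc (suc M) +_) (sym (toℕ-pred countdown)))
      where
      +-pred : ∀ {D} → D ≢ 0 → suc M + D ≡ suc (suc M) + ℕ.pred D
      +-pred {ℕ.zero} D≢0 = contradiction refl D≢0
      +-pred {suc D}  _   = +-suc (suc M) D
    old : ∀ x → toℕ x ≤ M × IsPow (toℕ x) → toℕ x ≤ toℕ (sat-suc max) × IsPow (toℕ x)
    old x (x≤M , pow) = ≤M⇒≤M′ x≤M , pow
    new : ∀ x → toℕ x ≤ toℕ (sat-suc max) × IsPow (toℕ x) → toℕ x ≤ M × IsPow (toℕ x)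
    new x (x≤M′ , pow) with ≤M′⇒≡M′⊎≤M x≤M′
    ... | inj₁ x≡M+1 = contradiction (Equivalence.to isPow-M+1⇔ (subst IsPow x≡M+1 pow)) D≢0
    ... | inj₂ x≤M   = x≤M , pow

powerTable-grow : ∀ {n} {max countdown : Fin (suc n)} {powers} →
  PowerTable max countdown powers → toℕ max < n → (δ? : Dec (countdown ≡ zero)) →
  PowerTable (sat-suc max) (if does δ? then max else Fin.pred countdown)
             (λ x → (does δ? ∧ᵇ does (x ≟ sat-suc max)) ∨ᵇ powers x)
powerTable-grow table max<n (yes countdown≡0) = PowerTableGrowth.grow-to-power table max<n countdown≡0
powerTable-grow table max<n (no countdown≢0)  = PowerTableGrowth.grow-below-power table max<n countdown≢0

module FormulaSemantics {s m : ℕ} {ar : Fin m → ℕ} where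

  infix 25 _≈_
  _≈_ : ∀ {k} → Term k → Term k → FO s m ar k
  t ≈ u = atom (eq t u)

  least : ∀ {k} → Fin k → FO s m ar k
  least i = neg (ex (atom (lt (var zero) (var (suc i)))))

  covers : ∀ {k} → Fin k → Fin k → FO s m ar k
  covers i j = atom (lt (var i) (var j))
             ∧ neg (ex (atom (lt (var (suc i)) (var zero)) ∧ atom (lt (var zero) (var (suc j)))))

  ifᶠ_then_else_ : ∀ {k} → FO s m ar k → FO s m ar k → FO s m ar k → FO s m ar k
  ifᶠ φ then ψ else χ = (φ ∧ ψ) ∨ (neg φ ∧ χ)

  module Satisfaction {n} (w : Word s n) (A : AuxInt n m ar) where

    least-sat : ∀ {k} (i : Fin k) ρ → SatFO w A (least i) ρ ⇔ ρ i ≡ zero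
    least-sat i ρ = mk⇔ (to (ρ i)) λ ρi≡0 (d , d<ρi) → n≮0 (subst (λ x → toℕ d < toℕ x) ρi≡0 d<ρi)
      where
      to : ∀ x → ¬ Σ (Fin (suc n)) (λ d → toℕ d < toℕ x) → x ≡ zero
      to zero    _    = refl
      to (suc x) none = contradiction (zero , s≤s z≤n) none

    covers-sat : ∀ {k} (i j : Fin k) ρ → SatFO w A (covers i j) ρ ⇔ toℕ (ρ j) ≡ suc (toℕ (ρ i))
    covers-sat i j ρ = mk⇔ to from
      where
      a b : Fin (suc n)
      a = ρ i
      b = ρ j
      to : SatFO w A (covers i j) ρ → toℕ b ≡ suc (toℕ a)
      to (a<b , nothing-between) with m≤n⇒m<n∨m≡n a<b
      ... | inj₂ a+1≡b = sym a+1≡b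
      ... | inj₁ a+1<b = contradiction (Fin.fromℕ< c<n , between) nothing-between
        where
        c<n : suc (toℕ a) < suc n
        c<n = <-trans a+1<b (toℕ<n b)
        between : toℕ a < toℕ (Fin.fromℕ< c<n) × toℕ (Fin.fromℕ< c<n) < toℕ b
        between rewrite toℕ-fromℕ< c<n = n<1+n (toℕ a) , a+1<b
      from : toℕ b ≡ suc (toℕ a) → SatFO w A (covers i j) ρ
      from b≡a+1 = ≤-reflexive (sym b≡a+1)
                 , λ (d , a<d , d<b) → <-irrefl refl (<-≤-trans a<d (ℕ.s≤s⁻¹ (subst (toℕ d <_) b≡a+1 d<b)))

    ifᶠ-sat : ∀ {k} {φ ψ χ : FO s m ar k} {ρ} {P : Set} {x a b : Fin (suc n)} →
              SatFO w A φ ρ ⇔ P → (P? : Dec P) → SatFO w A ψ ρ ⇔ x ≡ a → SatFO w A χ ρ ⇔ x ≡ b →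
              SatFO w A (ifᶠ φ then ψ else χ) ρ ⇔ x ≡ (if does P? then a else b)
    ifᶠ-sat φ⇔P (yes p) ψ⇔ χ⇔ = mk⇔ [ Equivalence.to ψ⇔ ∘ proj₂ , (λ (¬φ , _) → contradiction (Equivalence.from φ⇔P p) ¬φ) ]
                                    λ x≡a → inj₁ (Equivalence.from φ⇔P p , Equivalence.from ψ⇔ x≡a)
    ifᶠ-sat φ⇔P (no ¬p) ψ⇔ χ⇔ = mk⇔ [ (λ (φ , _) → contradiction (Equivalence.to φ⇔P φ) ¬p) , Equivalence.to χ⇔ ∘ proj₂ ]
                                    λ x≡b → inj₂ (¬p ∘ Equivalence.to φ⇔P , Equivalence.from χ⇔ x≡b)

module Circuits {s j : ℕ} (arity : Fin j → ℕ) where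

  -- Symbol 0 is the 0-ary query; symbol suc f holds the graph of a function with
  -- arity f arguments, output first.
  ar : Fin (suc j) → ℕ
  ar zero    = 0
  ar (suc f) = suc (arity f)

  data Circuit (k : ℕ) : Set where
    _≐_  : Term k → Term k → Circuit k
    gate : (f : Fin j) → Vec (Term k) (arity f) → Circuit (suc k) → Circuit k

  wk : ∀ {k} → Term k → Term (suc k)
  wk (var x) = var (suc x)
  wk dollar  = dollar

  toCQ : ∀ {k} → Circuit k → CQ s (suc j) ar k
  toCQ (t ≐ u)        = atom (eq t u)
  toCQ (gate f ts c)  = ex (atom (aux (suc f) (var zero ∷ Vec.map wk ts)) ∧ toCQ c)

  Interpretation : ℕ → Set
  Interpretation n = (f : Fin j) → Vec (Fin (suc n)) (arity f) → Fin (suc n)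

  IsGraph : ∀ {n} → AuxInt n (suc j) ar → Interpretation n → Set
  IsGraph A F = ∀ f y xs → A (suc f) (y ∷ xs) ⇔ y ≡ F f xs

  unchanged : (f : Fin j) → Circuit (suc (suc (arity f)))
  unchanged f = gate f (Vec.tabulate (λ i → var (suc (suc i)))) (var (suc (suc zero)) ≐ var zero)

  module Evaluation {n} (w : Word s n) (A : AuxInt n (suc j) ar) (F : Interpretation n) where

    -- An inductive family rather than a recursive function: unfolding a long circuit
    -- inside a type blows up, as the value of each gate mentions all earlier ones.
    data Runs : ∀ {k} → Circuit k → (Fin k → Fin (suc n)) → Set where
      holds  : ∀ {k t u} {ρ : Fin k → Fin (suc n)} → evalT w A ρ t ≡ evalT w A ρ u → Runs (t ≐ u) ρ
      passes : ∀ {k f ts c} {ρ : Fin k → Fin (suc n)} → Runs c (extend (F f (Vec.map (evalT w A ρ) ts)) ρ) → Runs (gate f ts c) ρ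

    Runs-≐ : ∀ {k t u} {ρ : Fin k → Fin (suc n)} → Runs (t ≐ u) ρ ⇔ evalT w A ρ t ≡ evalT w A ρ u
    Runs-≐ = mk⇔ (λ { (holds t≡u) → t≡u }) holds

    infixr 4 _↦_⨾_
    _↦_⨾_ : ∀ {k f ts} {c : Circuit (suc k)} {ρ} {R : Set} x →
            F f (Vec.map (evalT w A ρ) ts) ≡ x → Runs c (extend x ρ) ⇔ R → Runs (gate f ts c) ρ ⇔ R
    x ↦ refl ⨾ run⇔R = mk⇔ (λ { (passes r) → Equivalence.to run⇔R r }) (passes ∘ Equivalence.from run⇔R)

    evalT-wk : ∀ {k} d (ρ : Fin k → Fin (suc n)) t → evalT w A (extend d ρ) (wk t) ≡ evalT w A ρ t
    evalT-wk d ρ (var x) = refl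
    evalT-wk d ρ dollar  = refl

    toCQ-sound : IsGraph A F → ∀ {k} (c : Circuit k) ρ → SatCQ w A (toCQ c) ρ ⇔ Runs c ρ
    toCQ-sound graph (t ≐ u)       ρ = ⇔-sym Runs-≐
    toCQ-sound graph (gate f ts c) ρ = mk⇔ to from
      where
      args : ∀ d → Vec.map (evalT w A (extend d ρ)) (Vec.map wk ts) ≡ Vec.map (evalT w A ρ) ts
      args d = trans (sym (map-∘ _ wk ts)) (map-cong (evalT-wk d ρ) ts)
      v : Fin (suc n)
      v = F f (Vec.map (evalT w A ρ) ts)
      to : SatCQ w A (toCQ (gate f ts c)) ρ → Runs (gate f ts c) ρ
      to (d , graph-d , sat) = passes (subst (λ d → Runs c (extend d ρ)) d≡v (Equivalence.to (toCQ-sound graph c _) sat))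
        where
        d≡v : d ≡ v
        d≡v = trans (Equivalence.to (graph f d _) graph-d) (cong (F f) (args d))
      from : Runs (gate f ts c) ρ → SatCQ w A (toCQ (gate f ts c)) ρ
      from (passes r) = v , Equivalence.from (graph f v _) (cong (F f) (sym (args v)))
                 , Equivalence.from (toCQ-sound graph c _) r

    unchanged-run : ∀ f y out xs → Runs (unchanged f) (extend y (Vec.lookup (out ∷ xs))) ⇔ out ≡ F f xs
    unchanged-run f y out xs = F f xs ↦ cong (F f) args ⨾ Runs-≐
      where
      args : Vec.map (evalT w A (extend y (Vec.lookup (out ∷ xs)))) (Vec.tabulate (λ i → var (suc (suc i)))) ≡ xs
      args = trans (sym (tabulate-∘ _ _)) (tabulate∘lookup xs)


pattern Least     = zero
pattern Succ      = suc zero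
pattern Pred      = suc (suc zero)
pattern Equal     = suc (suc (suc zero))
pattern Ite       = suc (suc (suc (suc zero)))
pattern Empty     = suc (suc (suc (suc (suc zero))))
pattern Count     = suc (suc (suc (suc (suc (suc zero)))))
pattern Max       = suc (suc (suc (suc (suc (suc (suc zero))))))
pattern Countdown = suc (suc (suc (suc (suc (suc (suc (suc zero)))))))
pattern Powers    = suc (suc (suc (suc (suc (suc (suc (suc (suc zero))))))))

arity : Fin 10 → ℕ
arity Least     = 0
arity Succ      = 1
arity Pred      = 1
arity Equal     = 2
arity Ite       = 3
arity Empty     = 1
arity Count     = 0
arity Max       = 0
arity Countdown = 0
arity Powers    = 1

v : ∀ {k} (i : ℕ) {i<k : True (i ℕ.<? k)} → Term k
v i {i<k} = var (#_ i {m<n = i<k})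

module Program (s : ℕ) where
  open Circuits {s} arity public
  open FormulaSemantics {s} {0} {noAux}

  init : (r : Fin 11) → FO s 0 noAux (ar r)
  init zero            = neg (dollar ≈ dollar)
  init (suc Least)     = least (# 0)
  init (suc Succ)      = covers (# 1) (# 0) ∨ (v 1 ≈ dollar ∧ v 0 ≈ dollar)
  init (suc Pred)      = covers (# 0) (# 1) ∨ (least (# 1) ∧ v 0 ≈ v 1)
  init (suc Equal)     = ifᶠ v 1 ≈ v 2 then least (# 0) else v 0 ≈ dollar
  init (suc Ite)       = ifᶠ least (# 1) then v 0 ≈ v 2 else v 0 ≈ v 3
  init (suc Empty)     = least (# 0)
  init (suc Count)     = least (# 0)
  init (suc Max)       = least (# 0)
  init (suc Countdown) = least (# 0)
  init (suc Powers)    = v 0 ≈ dollar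

  -- The wires added, oldest first: e = Empty y for the updated position y = v 0,
  -- c, m, d, 0, [c = m], g = e ∧ [c = m] (a new maximum is reached), [d = 0],
  -- h = g ∧ [d = 0] (it is a power of two), c + 1, c′ = e ? c + 1 : c, m + 1,
  -- m′ = g ? m + 1 : m, d - 1, [d = 0] ? m : d - 1 and d′.
  withRegistersAfterIns : ∀ {k} → Circuit (16 + suc k) → Circuit (suc k)
  withRegistersAfterIns c =
    gate Empty (v 0 ∷ []) (gate Count [] (gate Max [] (gate Countdown [] (gate Least [] (
    gate Equal (v 3 ∷ v 2 ∷ []) (gate Ite (v 5 ∷ v 0 ∷ dollar ∷ []) (
    gate Equal (v 3 ∷ v 2 ∷ []) (gate Ite (v 1 ∷ v 0 ∷ dollar ∷ []) (
    gate Succ (v 7 ∷ []) (gate Ite (v 9 ∷ v 0 ∷ v 8 ∷ []) (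
    gate Succ (v 8 ∷ []) (gate Ite (v 5 ∷ v 0 ∷ v 9 ∷ []) (
    gate Pred (v 9 ∷ []) (gate Ite (v 6 ∷ v 11 ∷ v 0 ∷ []) (gate Ite (v 8 ∷ v 0 ∷ v 11 ∷ []) c)))))))))))))))

  -- Adds the wires powers t, [t = m′], h ∧ [t = m′] and (h ∧ [t = m′]) ∨ powers t.
  powersAfterInsAt : ∀ {k} → Term (16 + k) → Circuit (20 + k) → Circuit (16 + k)
  powersAfterInsAt t c =
    gate Powers (t ∷ []) (gate Equal (wk t ∷ v 4 ∷ []) (
    gate Ite (v 9 ∷ v 0 ∷ dollar ∷ []) (gate Ite (v 0 ∷ v 14 ∷ v 2 ∷ []) c)))

  -- In the update formula of a function symbol, v 0 is the updated position, v 1 the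
  -- output and v 2, … the arguments.
  insCircuit : (r : Fin 11) → Circuit (suc (ar r))
  insCircuit zero            = withRegistersAfterIns (powersAfterInsAt (v 5) (v 15 ≐ v 0))
  insCircuit (suc Empty)     =
    gate Equal (v 2 ∷ v 0 ∷ []) (gate Empty (v 3 ∷ []) (gate Ite (v 1 ∷ dollar ∷ v 0 ∷ []) (v 4 ≐ v 0)))
  insCircuit (suc Count)     = withRegistersAfterIns (v 17 ≐ v 5)
  insCircuit (suc Max)       = withRegistersAfterIns (v 17 ≐ v 3)
  insCircuit (suc Countdown) = withRegistersAfterIns (v 17 ≐ v 0)
  insCircuit (suc Powers)    = withRegistersAfterIns (powersAfterInsAt (v 18) (v 21 ≐ v 0))
  insCircuit (suc Least)     = unchanged Least
  insCircuit (suc Succ)      = unchanged Succ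
  insCircuit (suc Pred)      = unchanged Pred
  insCircuit (suc Equal)     = unchanged Equal
  insCircuit (suc Ite)       = unchanged Ite

  resetCircuit : (r : Fin 11) → Circuit (suc (ar r))
  resetCircuit zero        =
    gate Count [] (gate Pred (v 0 ∷ []) (gate Powers (v 0 ∷ []) (gate Least [] (v 0 ≐ v 1))))
  resetCircuit (suc Empty) =
    gate Equal (v 2 ∷ v 0 ∷ []) (gate Empty (v 3 ∷ []) (gate Least [] (gate Ite (v 2 ∷ v 0 ∷ v 1 ∷ []) (v 5 ≐ v 0))))
  resetCircuit (suc Count) = gate Count [] (gate Pred (v 0 ∷ []) (v 3 ≐ v 0))
  resetCircuit (suc f)     = unchanged f

  program : DynCQProgram s
  program = record
    { m      = 11
    ; ar     = ar
    ; init   = init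
    ; updIns = λ _ r → toCQ (insCircuit r)
    ; updRes = λ r → toCQ (resetCircuit r)
    }

module Correctness (s : ℕ) where
  open Program s
  open Run program
  open FormulaSemantics {s} {0} {noAux}

  record State (n : ℕ) : Set where
    field
      count max countdown : Fin (suc n)
      powers              : Fin (suc n) → Bool

  intended : ∀ {n} → Word s n → State n → Interpretation n
  intended w st Least     []               = zero
  intended w st Succ      (a ∷ [])         = sat-suc a
  intended w st Pred      (a ∷ [])         = Fin.pred a
  intended w st Equal     (x ∷ y ∷ [])     = eqBit x y
  intended w st Ite       (c ∷ a ∷ b ∷ []) = ite c a b
  intended w st Empty     (p ∷ [])         = bit (is-nothing (at w p))
  intended w st Count     []               = State.count st
  intended w st Max       []               = State.max st
  intended w st Countdown []               = State.countdown st
  intended w st Powers    (x ∷ [])         = bit (State.powers st x)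

  record Consistent {n} (w : Word s n) (st : State n) : Set where
    open State st
    field
      count-filled : toℕ count ≡ filled w
      count≤max    : toℕ count ≤ toℕ max
      table        : PowerTable max countdown powers

  record Invariant {n} (w : Word s n) (A : AuxInt n 11 ar) : Set where
    field
      state      : State n
      consistent : Consistent w state
      graph      : IsGraph A (intended w state)
      query      : A zero [] ⇔ PowLen (word w)

  powers-count⇔ : ∀ {n} {w : Word s n} {st} → Consistent w st → T (State.powers st (State.count st)) ⇔ PowLen (word w)
  powers-count⇔ {st = st} cons =
    mk⇔ (λ t → subst IsPow count-filled (proj₂ (Equivalence.to (powers-spec count) t)))
        (λ pow → Equivalence.from (powers-spec count) (count≤max , subst IsPow (sym count-filled) pow))
    where
    open State st
    open Consistent cons
    open PowerTable table

  initialState : ∀ {n} → State n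
  initialState = record { count = zero ; max = zero ; countdown = zero ; powers = λ _ → false }

  initial-consistent : ∀ {n} → Consistent (emptyWord {s} {n}) initialState
  initial-consistent {n} = record
    { count-filled = sym (filled-empty {s} {n})
    ; count≤max    = z≤n
    ; table        = record
      { countdown≤max = z≤n
      ; isPow-target  = 0 , refl
      ; powers-spec   = λ x → mk⇔ (λ ()) λ (x≤0 , pow) → ¬isPow-0 (subst IsPow (n≤0⇒n≡0 x≤0) pow)
      }
    }

  initial-graph : ∀ {n} → IsGraph (initAux {n}) (intended emptyWord initialState)
  initial-graph {n} f y xs = sat f xs
    where
    open Satisfaction (emptyWord {s} {n}) noAuxInt
    sat : ∀ f xs → SatFO emptyWord noAuxInt (init (suc f)) (Vec.lookup (y ∷ xs)) ⇔ y ≡ intended emptyWord initialState f xs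
    sat Least     []               = least-sat (# 0) (Vec.lookup (y ∷ []))
    sat Succ      (a ∷ [])         = ⇔-sym (sat-suc-graph a y) ⇔-∘ (covers-sat (# 1) (# 0) (Vec.lookup (y ∷ a ∷ [])) ⊎-⇔ mk⇔ id id)
    sat Pred      (a ∷ [])         =
      ⇔-sym (pred-graph a y) ⇔-∘ (covers-sat (# 0) (# 1) (Vec.lookup (y ∷ a ∷ [])) ⊎-⇔ (least-sat (# 1) (Vec.lookup (y ∷ a ∷ [])) ×-⇔ mk⇔ id id))
    sat Equal     (a ∷ b ∷ [])     =
      ifᶠ-sat {φ = v 1 ≈ v 2} {ψ = least (# 0)} {χ = v 0 ≈ dollar} {ρ = Vec.lookup (y ∷ a ∷ b ∷ [])}
              (mk⇔ id id) (a ≟ b) (least-sat (# 0) (Vec.lookup (y ∷ a ∷ b ∷ []))) (mk⇔ id id)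
    sat Ite       (c ∷ a ∷ b ∷ []) =
      ifᶠ-sat {φ = least (# 1)} {ψ = v 0 ≈ v 2} {χ = v 0 ≈ v 3} {ρ = Vec.lookup (y ∷ c ∷ a ∷ b ∷ [])}
              (least-sat (# 1) (Vec.lookup (y ∷ c ∷ a ∷ b ∷ []))) (c ≟ zero) (mk⇔ id id) (mk⇔ id id)
    sat Empty     (p ∷ [])         =
      ≡⇔ (cong (bit ∘ is-nothing) (sym (at-empty {s} {n} p))) ⇔-∘ least-sat (# 0) (Vec.lookup (y ∷ p ∷ []))
    sat Count     []               = least-sat (# 0) (Vec.lookup (y ∷ []))
    sat Max       []               = least-sat (# 0) (Vec.lookup (y ∷ []))
    sat Countdown []               = least-sat (# 0) (Vec.lookup (y ∷ []))
    sat Powers    (x ∷ [])         = mk⇔ id id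

  initial : ∀ {n} → Invariant (emptyWord {s} {n}) initAux
  initial {n} = record
    { state      = initialState
    ; consistent = initial-consistent
    ; graph      = initial-graph
    ; query      = mk⇔ (λ $≢$ → contradiction refl $≢$) (λ pow _ → ¬isPow-0 (subst IsPow (filled-empty {s} {n}) pow))
    }

  insState : ∀ {n} (st : State n) → Bool → Dec (State.count st ≡ State.max st) → Dec (State.countdown st ≡ zero) → State n
  insState {n} st ε atMax? zero? = record
    { count     = if ε then sat-suc count else count
    ; max       = max′
    ; countdown = if newMax then (if does zero? then max else Fin.pred countdown) else countdown
    ; powers    = λ x → ((newMax ∧ᵇ does zero?) ∧ᵇ does (x ≟ max′)) ∨ᵇ powers x
    }
    where
    open State st
    newMax : Bool
    newMax = ε ∧ᵇ does atMax?
    max′ : Fin (suc n)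
    max′ = if newMax then sat-suc max else max

  resetState : ∀ {n} → State n → State n
  resetState st = record st { count = Fin.pred (State.count st) }

  insConsistent : ∀ {n} {w w′ : Word s n} {st} ε atMax? zero? →
    Consistent w st → filled w′ ≡ (if ε then suc (filled w) else filled w) → filled w′ ≤ n →
    Consistent w′ (insState st ε atMax? zero?)
  insConsistent false _ _ cons filled≡ _ = record
    { count-filled = trans count-filled (sym filled≡)
    ; count≤max    = count≤max
    ; table        = table
    }
    where open Consistent cons
  insConsistent {n} {w′ = w′} {st} true atMax? zero? cons filled≡ filled≤n = grown atMax?
    where
    open State st
    open Consistent cons
    count<n : toℕ count < n
    count<n = subst (λ k → suc k ≤ n) (sym count-filled) (subst (_≤ n) filled≡ filled≤n)
    count′-filled : toℕ (sat-suc count) ≡ filled w′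
    count′-filled = trans (toℕ-sat-suc count count<n) (trans (cong suc count-filled) (sym filled≡))
    grown : (atMax? : Dec (count ≡ max)) → Consistent w′ (insState st true atMax? zero?)
    grown (no count≢max) = record
      { count-filled = count′-filled
      ; count≤max    = subst (_≤ toℕ max) (sym (toℕ-sat-suc count count<n)) (≤∧≢⇒< count≤max (count≢max ∘ toℕ-injective))
      ; table        = table
      }
    grown (yes count≡max) = record
      { count-filled = count′-filled
      ; count≤max    = ≤-reflexive (cong (toℕ ∘ sat-suc) count≡max)
      ; table        = powerTable-grow table (subst (λ c → toℕ c < n) count≡max count<n) zero?
      }

  resetConsistent : ∀ {n} {w w′ : Word s n} {st} → Consistent w st → suc (filled w′) ≡ filled w → Consistent w′ (resetState st)
  resetConsistent {st = st} cons filled≡ = record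
    { count-filled = trans (toℕ-pred count) (trans (cong ℕ.pred count-filled) (cong ℕ.pred (sym filled≡)))
    ; count≤max    = ≤-trans (≤-trans (≤-reflexive (toℕ-pred count)) pred[n]≤n) count≤max
    ; table        = table
    }
    where
    open State st
    open Consistent cons

  empty-bit-update : ∀ {n} (w : Word s (suc n)) i v p →
    ite (eqBit p (inject₁ i)) (bit (is-nothing v)) (bit (is-nothing (at w p))) ≡ bit (is-nothing (at (w [ i ]≔ v) p))
  empty-bit-update w i v p = begin
    ite (eqBit p (inject₁ i)) (bit (is-nothing v)) (bit (is-nothing (at w p)))
      ≡⟨ ite-bit (does (p ≟ inject₁ i)) ⟩
    (if does (p ≟ inject₁ i) then bit (is-nothing v) else bit (is-nothing (at w p)))
      ≡⟨ if-float (bit ∘ is-nothing) (does (p ≟ inject₁ i)) ⟨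
    bit (is-nothing (if does (p ≟ inject₁ i) then v else at w p))
      ≡⟨ cong (bit ∘ is-nothing) (at-update w i v p) ⟨
    bit (is-nothing (at (w [ i ]≔ v) p)) ∎
    where open ≡-Reasoning

  module Insertion {n} {w : Word s (suc n)} {A : AuxInt (suc n) 11 ar} (inv : Invariant w A) (ζ : Fin s) (i : Fin (suc n)) where
    open Invariant inv
    open State state
    open Evaluation (w [ i ]≔ just ζ) A (intended w state)

    ε : Bool
    ε = is-nothing (at w (inject₁ i))

    state′ : State (suc n)
    state′ = insState state ε (count ≟ max) (countdown ≟ zero)

    newMax δ : Bool
    newMax = ε ∧ᵇ does (count ≟ max)
    δ      = does (countdown ≟ zero)

    e atMax g dz h count′ max′ countdown′ : Fin (suc (suc n))
    e          = bit ε
    atMax      = eqBit count max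
    g          = ite e atMax (bit false)
    dz         = eqBit countdown zero
    h          = ite g dz (bit false)
    count′     = ite e (sat-suc count) count
    max′       = ite g (sat-suc max) max
    countdown′ = ite g (ite dz max (Fin.pred countdown)) countdown

    registers : ∀ {k} → (Fin k → Fin (suc (suc n))) → Fin (16 + suc k) → Fin (suc (suc n))
    registers ρ =
      extend countdown′ (extend (ite dz max (Fin.pred countdown)) (extend (Fin.pred countdown) (
      extend max′ (extend (sat-suc max) (extend count′ (extend (sat-suc count) (
      extend h (extend dz (extend g (extend atMax (
      extend zero (extend countdown (extend max (extend count (extend e (extend (inject₁ i) ρ))))))))))))))))

    registers-run : ∀ {k} (c : Circuit (16 + suc k)) ρ → Runs (withRegistersAfterIns c) (extend (inject₁ i) ρ) ⇔ Runs c (registers ρ)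
    registers-run c ρ =
      e ↦ refl ⨾ count ↦ refl ⨾ max ↦ refl ⨾ countdown ↦ refl ⨾ zero ↦ refl ⨾
      atMax ↦ refl ⨾ g ↦ refl ⨾ dz ↦ refl ⨾ h ↦ refl ⨾
      sat-suc count ↦ refl ⨾ count′ ↦ refl ⨾ sat-suc max ↦ refl ⨾ max′ ↦ refl ⨾
      Fin.pred countdown ↦ refl ⨾ ite dz max (Fin.pred countdown) ↦ refl ⨾ countdown′ ↦ refl ⨾ mk⇔ id id

    newPowers : Fin (suc (suc n)) → Fin (suc (suc n))
    newPowers x = ite (ite h (eqBit x max′) (bit false)) (bit true) (bit (powers x))

    powers-run : ∀ {k} t (c : Circuit (20 + suc k)) ρ x → evalT (w [ i ]≔ just ζ) A (registers ρ) t ≡ x →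
      Runs (powersAfterInsAt t c) (registers ρ)
      ⇔ Runs c (extend (newPowers x) (extend (ite h (eqBit x max′) (bit false)) (extend (eqBit x max′) (extend (bit (powers x)) (registers ρ)))))
    powers-run t c ρ x t≡x =
      bit (powers x) ↦ cong (bit ∘ powers) t≡x ⨾
      eqBit x max′ ↦ cong (λ a → eqBit a max′) (trans (evalT-wk _ _ t) t≡x) ⨾
      ite h (eqBit x max′) (bit false) ↦ refl ⨾
      newPowers x ↦ refl ⨾ mk⇔ id id

    g≡ : g ≡ bit newMax
    g≡ = ite-bit-∧ ε

    count′≡ : count′ ≡ State.count state′
    count′≡ = ite-bit ε

    max′≡ : max′ ≡ State.max state′
    max′≡ = trans (cong (λ x → ite x (sat-suc max) max) g≡) (ite-bit newMax)

    countdown′≡ : countdown′ ≡ State.countdown state′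
    countdown′≡ = trans (cong₂ (λ x y → ite x y countdown) g≡ (ite-bit δ)) (ite-bit newMax)

    newPowers≡ : ∀ x → newPowers x ≡ bit (State.powers state′ x)
    newPowers≡ x = begin
      ite (ite h (eqBit x max′) (bit false)) (bit true) (bit (powers x))
        ≡⟨ cong (λ y → ite y (bit true) (bit (powers x))) (cong₂ (λ y m → ite y (eqBit x m) (bit false)) h≡ max′≡) ⟩
      ite (ite (bit (newMax ∧ᵇ δ)) (eqBit x (State.max state′)) (bit false)) (bit true) (bit (powers x))
        ≡⟨ cong (λ y → ite y (bit true) (bit (powers x))) (ite-bit-∧ (newMax ∧ᵇ δ)) ⟩
      ite (bit ((newMax ∧ᵇ δ) ∧ᵇ does (x ≟ State.max state′))) (bit true) (bit (powers x))
        ≡⟨ ite-bit-∨ ((newMax ∧ᵇ δ) ∧ᵇ does (x ≟ State.max state′)) ⟩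
      bit (State.powers state′ x) ∎
      where
      open ≡-Reasoning
      h≡ : h ≡ bit (newMax ∧ᵇ δ)
      h≡ = trans (cong (λ y → ite y dz (bit false)) g≡) (ite-bit-∧ newMax)

    run-updated : ∀ f out xs → Runs (insCircuit (suc f)) (extend (inject₁ i) (Vec.lookup (out ∷ xs)))
                             ⇔ out ≡ intended (w [ i ]≔ just ζ) state′ f xs
    run-updated Least     out []               = unchanged-run Least (inject₁ i) out []
    run-updated Succ      out (a ∷ [])         = unchanged-run Succ (inject₁ i) out (a ∷ [])
    run-updated Pred      out (a ∷ [])         = unchanged-run Pred (inject₁ i) out (a ∷ [])
    run-updated Equal     out (a ∷ b ∷ [])     = unchanged-run Equal (inject₁ i) out (a ∷ b ∷ [])
    run-updated Ite       out (c ∷ a ∷ b ∷ []) = unchanged-run Ite (inject₁ i) out (c ∷ a ∷ b ∷ [])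
    run-updated Empty     out (p ∷ [])         = _ ↦ refl ⨾ _ ↦ refl ⨾ _ ↦ refl ⨾ ≡⇔ (empty-bit-update w i (just ζ) p) ⇔-∘ Runs-≐
    run-updated Count     out []               = ≡⇔ count′≡ ⇔-∘ (Runs-≐ ⇔-∘ registers-run (v 17 ≐ v 5) _)
    run-updated Max       out []               = ≡⇔ max′≡ ⇔-∘ (Runs-≐ ⇔-∘ registers-run (v 17 ≐ v 3) _)
    run-updated Countdown out []               = ≡⇔ countdown′≡ ⇔-∘ (Runs-≐ ⇔-∘ registers-run (v 17 ≐ v 0) _)
    run-updated Powers    out (x ∷ [])         =
      ≡⇔ (newPowers≡ x) ⇔-∘ (Runs-≐ ⇔-∘ (powers-run (v 18) (v 21 ≐ v 0) _ x refl ⇔-∘ registers-run _ _))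

    run-query : Runs (insCircuit zero) (extend (inject₁ i) (Vec.lookup [])) ⇔ T (State.powers state′ (State.count state′))
    run-query = zero≡bit⇔T ⇔-∘ (≡⇔ (trans (newPowers≡ count′) (cong (bit ∘ State.powers state′) count′≡))
                ⇔-∘ (Runs-≐ ⇔-∘ (powers-run (v 5) (v 15 ≐ v 0) _ count′ refl ⇔-∘ registers-run _ _)))

    consistent′ : Consistent (w [ i ]≔ just ζ) state′
    consistent′ = insConsistent ε (count ≟ max) (countdown ≟ zero) consistent filled-step (filled≤ (w [ i ]≔ just ζ))
      where
      filled-step : filled (w [ i ]≔ just ζ) ≡ (if ε then suc (filled w) else filled w)
      filled-step = subst (λ m → filled (w [ i ]≔ just ζ) ≡ (if is-nothing m then suc (filled w) else filled w))
                          (sym (at-inject₁ w i)) (filled-ins w i ζ)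

    invariant′ : Invariant (applyUpd w (ins ζ i)) (stepAux w A (ins ζ i))
    invariant′ = record
      { state      = state′
      ; consistent = consistent′
      ; graph      = λ f out xs → run-updated f out xs ⇔-∘ toCQ-sound graph (insCircuit (suc f)) _
      ; query      = powers-count⇔ consistent′ ⇔-∘ (run-query ⇔-∘ toCQ-sound graph (insCircuit zero) _)
      }

  module Reset {n} {w : Word s (suc n)} {A : AuxInt (suc n) 11 ar} (inv : Invariant w A) (i : Fin (suc n)) (filled-i : w i ≢ nothing) where
    open Invariant inv
    open Evaluation (w [ i ]≔ nothing) A (intended w state)

    run-updated : ∀ f out xs → Runs (resetCircuit (suc f)) (extend (inject₁ i) (Vec.lookup (out ∷ xs)))
                             ⇔ out ≡ intended (w [ i ]≔ nothing) (resetState state) f xs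
    run-updated Least     out []               = unchanged-run Least (inject₁ i) out []
    run-updated Succ      out (a ∷ [])         = unchanged-run Succ (inject₁ i) out (a ∷ [])
    run-updated Pred      out (a ∷ [])         = unchanged-run Pred (inject₁ i) out (a ∷ [])
    run-updated Equal     out (a ∷ b ∷ [])     = unchanged-run Equal (inject₁ i) out (a ∷ b ∷ [])
    run-updated Ite       out (c ∷ a ∷ b ∷ []) = unchanged-run Ite (inject₁ i) out (c ∷ a ∷ b ∷ [])
    run-updated Empty     out (p ∷ [])         = _ ↦ refl ⨾ _ ↦ refl ⨾ _ ↦ refl ⨾ _ ↦ refl ⨾ ≡⇔ (empty-bit-update w i nothing p) ⇔-∘ Runs-≐
    run-updated Count     out []               = _ ↦ refl ⨾ _ ↦ refl ⨾ Runs-≐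
    run-updated Max       out []               = unchanged-run Max (inject₁ i) out []
    run-updated Countdown out []               = unchanged-run Countdown (inject₁ i) out []
    run-updated Powers    out (x ∷ [])         = unchanged-run Powers (inject₁ i) out (x ∷ [])

    run-query : Runs (resetCircuit zero) (extend (inject₁ i) (Vec.lookup [])) ⇔ zero ≡ bit (State.powers state (Fin.pred (State.count state)))
    run-query = _ ↦ refl ⨾ _ ↦ refl ⨾ _ ↦ refl ⨾ _ ↦ refl ⨾ Runs-≐

    consistent′ : Consistent (w [ i ]≔ nothing) (resetState state)
    consistent′ = resetConsistent consistent (filled-reset w i filled-i)

    invariant′ : Invariant (applyUpd w (reset i)) (stepAux w A (reset i))
    invariant′ = record
      { state      = resetState state
      ; consistent = consistent′
      ; graph      = λ f out xs → run-updated f out xs ⇔-∘ toCQ-sound graph (resetCircuit (suc f)) _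
      ; query      = powers-count⇔ consistent′ ⇔-∘ (zero≡bit⇔T ⇔-∘ (run-query ⇔-∘ toCQ-sound graph (resetCircuit zero) _))
      }

  invariant : ∀ {n} {w : Word s n} {A} → Reachable w A → Invariant w A
  invariant start                                   = initial
  invariant {suc n} (step (ins ζ i) reachable _)     = Insertion.invariant′ (invariant reachable) ζ i
  invariant {suc n} (step (reset i) reachable filled-i) = Reset.invariant′ (invariant reachable) i filled-i

  maintains : Maintains program zero PowLen
  maintains = refl , λ { w A reachable [] → Invariant.query (invariant reachable) }

lemma4p2 : (s : ℕ) → MaintainableInDynCQ {s} PowLen
lemma4p2 s = Program.program s , zero , Correctness.maintains s
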